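{- Let $\mathbf D$ and $\mathbf M$ be fully contextual double Boolean algebras. Then $\mathbf D$ is isomorphic to $\mathbf M$ if and only if $\mathbf D_p$ is isomorphic to $\mathbf M_p$. Moreover, every dBa isomorphism from $\mathbf D_p$ to $\mathbf M_p$ extends uniquely to a dBa isomorphism from $\mathbf D$ to $\mathbf M$.
   Context: A double Boolean algebra (dBa) is an algebra $\mathbf{D}=(D,\sqcup,\sqcap,\neg,\lrcorner,\top,\bot)$ of type $(2,2,1,1,0,0)$ such that, with $x\vee y:=\neg(\neg x\sqcap\neg y)$ and $x\wedge y:=\lrcorner(\lrcorner x\sqcup\lrcorner y)$, for all $x,y,z\in D$: $(x\sqcap x)\sqcap y=x\sqcap y$; $x\sqcap y=y\sqcap x$; $x\sqcap(y\sqcap z)=(x\sqcap y)\sqcap z$; $\neg(x\sqcap x)=\neg x$; $x\sqcap(x\sqcup y)=x\sqcap x$; $x\sqcap(y\vee z)=(x\sqcap y)\vee(x\sqcap z)$; $x\sqcap(x\vee y)=x\sqcap x$; $\neg\neg(x\sqcap y)=x\sqcap y$; $x\sqcap\neg x=\bot$; $\neg\bot=\top\sqcap\top$; $\neg\top=\bot$; the duals $(x\sqcup x)\sqcup y=x\sqcup y$; $x\sqcup y=y\sqcup x$; $x\sqcup(y\sqcup z)=(x\sqcup y)\sqcup z$; $\lrcorner(x\sqcup x)=\lrcorner x$; $x\sqcup(x\sqcap y)=x\sqcup x$; $x\sqcup(y\wedge z)=(x\sqcup y)\wedge(x\sqcup z)$; $x\sqcup(x\wedge y)=x\sqcup x$;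 $\lrcorner\lrcorner(x\sqcup y)=x\sqcup y$; $x\sqcup\lrcorner x=\top$; $\lrcorner\top=\bot\sqcup\bot$; $\lrcorner\bot=\top$; and $(x\sqcap x)\sqcup(x\sqcap x)=(x\sqcup x)\sqcap(x\sqcup x)$. The quasi-order is $x\sqsubseteq y$ iff $x\sqcap y=x\sqcap x$ and $x\sqcup y=y\sqcup y$. $x_\sqcap:=x\sqcap x$, $x_\sqcup:=x\sqcup x$, $D_\sqcap:=\{x:x_\sqcap=x\}$, $D_\sqcup:=\{x:x_\sqcup=x\}$, $D_p:=D_\sqcap\cup D_\sqcup$; $\mathbf D_p$ is the subalgebra of $\mathbf D$ with universe $D_p$ (it is closed under all operations). $\mathbf D$ is fully contextual if $\sqsubseteq$ is a partial order and for all $y\in D_\sqcap$, $x\in D_\sqcup$ with $y_\sqcup=x_\sqcap$ there is a unique $z\in D$ with $z_\sqcap=y$, $z_\sqcup=x$. A dBa isomorphism is a bijection preserving $\sqcup,\sqcap,\neg,\lrcorner,\top,\bot$. -}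

module Defs where

open import Level using (Level) renaming (suc to lsuc; _⊔_ to _⊔ˡ_)
open import Data.Product using (Σ; ∃; _×_; _,_; ∃-syntax)
open import Data.Sum using (_⊎_)
open import Relation.Binary.PropositionalEquality using (_≡_)
open import Relation.Binary.Structures using (IsPartialOrder)
open import Function.Definitions using (Bijective)


record DBA (a : Level) : Set (lsuc a) where
  infixl 7 _⊓_ _∧_
  infixl 6 _⊔_ _∨_
  infix 8 ¬_ ⌟_
  field
    Carrier : Set a
    _⊔_ _⊓_ : Carrier → Carrier → Carrier
    ¬_ ⌟_ : Carrier → Carrier
    ⊤ ⊥ : Carrier

  _∨_ : Carrier → Carrier → Carrier
  x ∨ y = ¬ ((¬ x) ⊓ (¬ y))

  _∧_ : Carrier → Carrier → Carrier
  x ∧ y = ⌟ ((⌟ x) ⊔ (⌟ y))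

  field
    ⊓-idem-left : ∀ x y → (x ⊓ x) ⊓ y ≡ x ⊓ y
    ⊓-comm : ∀ x y → x ⊓ y ≡ y ⊓ x
    ⊓-assoc : ∀ x y z → x ⊓ (y ⊓ z) ≡ (x ⊓ y) ⊓ z
    ¬-⊓-idem : ∀ x → ¬ (x ⊓ x) ≡ ¬ x
    ⊓-absorb-⊔ : ∀ x y → x ⊓ (x ⊔ y) ≡ x ⊓ x
    ⊓-distrib-∨ : ∀ x y z → x ⊓ (y ∨ z) ≡ (x ⊓ y) ∨ (x ⊓ z)
    ⊓-absorb-∨ : ∀ x y → x ⊓ (x ∨ y) ≡ x ⊓ x
    ¬¬-⊓ : ∀ x y → ¬ (¬ (x ⊓ y)) ≡ x ⊓ y
    ⊓-¬ : ∀ x → x ⊓ (¬ x) ≡ ⊥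
    ¬⊥ : ¬ ⊥ ≡ ⊤ ⊓ ⊤
    ¬⊤ : ¬ ⊤ ≡ ⊥
    ⊔-idem-left : ∀ x y → (x ⊔ x) ⊔ y ≡ x ⊔ y
    ⊔-comm : ∀ x y → x ⊔ y ≡ y ⊔ x
    ⊔-assoc : ∀ x y z → x ⊔ (y ⊔ z) ≡ (x ⊔ y) ⊔ z
    ⌟-⊔-idem : ∀ x → ⌟ (x ⊔ x) ≡ ⌟ x
    ⊔-absorb-⊓ : ∀ x y → x ⊔ (x ⊓ y) ≡ x ⊔ x
    ⊔-distrib-∧ : ∀ x y z → x ⊔ (y ∧ z) ≡ (x ⊔ y) ∧ (x ⊔ z)
    ⊔-absorb-∧ : ∀ x y → x ⊔ (x ∧ y) ≡ x ⊔ x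
    ⌟⌟-⊔ : ∀ x y → ⌟ (⌟ (x ⊔ y)) ≡ x ⊔ y
    ⊔-⌟ : ∀ x → x ⊔ (⌟ x) ≡ ⊤
    ⌟⊤ : ⌟ ⊤ ≡ ⊥ ⊔ ⊥
    ⌟⊥ : ⌟ ⊥ ≡ ⊤
    mixed : ∀ x → (x ⊓ x) ⊔ (x ⊓ x) ≡ (x ⊔ x) ⊓ (x ⊔ x)

  _⊑_ : Carrier → Carrier → Set a
  x ⊑ y = (x ⊓ y ≡ x ⊓ x) × (x ⊔ y ≡ y ⊔ y)

  _₊⊓ : Carrier → Carrier
  x ₊⊓ = x ⊓ x

  _₊⊔ : Carrier → Carrier
  x ₊⊔ = x ⊔ x

  In⊓ : Carrier → Set a
  In⊓ x = x ⊓ x ≡ x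

  In⊔ : Carrier → Set a
  In⊔ x = x ⊔ x ≡ x

  InP : Carrier → Set a
  InP x = In⊓ x ⊎ In⊔ x

∃!⟨_⟩ : ∀ {a b} (A : Set a) → (A → Set b) → Set (a ⊔ˡ b)
∃!⟨ A ⟩ P = Σ A λ z → P z × (∀ z' → P z' → z' ≡ z)

FullyContextual : ∀ {a} → DBA a → Set a
FullyContextual D =
  IsPartialOrder _≡_ _⊑_ ×
  (∀ y x → In⊓ y → In⊔ x → y ₊⊔ ≡ x ₊⊓ →
     ∃!⟨ Carrier ⟩ (λ z → (z ₊⊓ ≡ y) × (z ₊⊔ ≡ x)))
  where open DBA D

IsIso : ∀ {a b} (D : DBA a) (M : DBA b) → (DBA.Carrier D → DBA.Carrier M) → Set (a ⊔ˡ b)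
IsIso D M f =
  Bijective _≡_ _≡_ f ×
  (∀ x y → f (x D.⊔ y) ≡ f x M.⊔ f y) ×
  (∀ x y → f (x D.⊓ y) ≡ f x M.⊓ f y) ×
  (∀ x → f (D.¬ x) ≡ M.¬ (f x)) ×
  (∀ x → f (D.⌟ x) ≡ M.⌟ (f x)) ×
  (f D.⊤ ≡ M.⊤) ×
  (f D.⊥ ≡ M.⊥)
  where module D = DBA D
        module M = DBA M

-- A dBa isomorphism D_p → M_p, represented by a function g : D → M of which
-- only the restriction to D_p matters: g maps D_p into M_p, is injective
-- on D_p, onto M_p, and preserves all operations on arguments from D_p.
IsPIso : ∀ {a b} (D : DBA a) (M : DBA b) → (DBA.Carrier D → DBA.Carrier M) → Set (a ⊔ˡ b)
IsPIso D M g =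
  (∀ x → D.InP x → M.InP (g x)) ×
  (∀ x y → D.InP x → D.InP y → g x ≡ g y → x ≡ y) ×
  (∀ u → M.InP u → ∃[ x ] (D.InP x × g x ≡ u)) ×
  (∀ x y → D.InP x → D.InP y → g (x D.⊔ y) ≡ g x M.⊔ g y) ×
  (∀ x y → D.InP x → D.InP y → g (x D.⊓ y) ≡ g x M.⊓ g y) ×
  (∀ x → D.InP x → g (D.¬ x) ≡ M.¬ (g x)) ×
  (∀ x → D.InP x → g (D.⌟ x) ≡ M.⌟ (g x)) ×
  (g D.⊤ ≡ M.⊤) ×
  (g D.⊥ ≡ M.⊥)
  where module D = DBA D
        module M = DBA M

Extends : ∀ {a b} (D : DBA a) (M : DBA b) → (f g : DBA.Carrier D → DBA.Carrier M) → Set (a ⊔ˡ b)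
Extends D M f g = ∀ x → DBA.InP D x → f x ≡ g x

-- In a fully contextual dBa every element z is uniquely determined by its two
-- components z ⊓ z ∈ D_⊓ and z ⊔ z ∈ D_⊔, and every compatible pair of
-- components (y ⊔ y = x ⊓ x) occurs. Every operation of a dBa is computed from
-- the components of its arguments, and the results of ⊓, ¬, ⊥ lie in D_⊓ and
-- those of ⊔, ⌟, ⊤ in D_⊔. Hence an isomorphism g : D_p → M_p extends by
-- sending z to the element of M with components g (z ⊓ z) and g (z ⊔ z), and
-- any isomorphism extending g must do exactly this.
module Submission where

open import Defs
open import Level using (Level)
open import Data.Product using (Σ; _×_; _,_; proj₁; proj₂; Σ-syntax; ∃-syntax)
open import Data.Sum using (inj₁; inj₂)
open import Relation.Binary.PropositionalEquality
  using (_≡_; refl; sym; trans; cong; cong₂; subst; module ≡-Reasoning)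
open import Function.Consequences.Propositional
  using (strictlySurjective⇒surjective; surjective⇒strictlySurjective)

private
  variable
    a b : Level

dual : DBA a → DBA a
dual D = record
  { Carrier = Carrier
  ; _⊔_ = _⊓_
  ; _⊓_ = _⊔_
  ; ¬_ = ⌟_
  ; ⌟_ = ¬_
  ; ⊤ = ⊥
  ; ⊥ = ⊤
  ; ⊓-idem-left = ⊔-idem-left
  ; ⊓-comm = ⊔-comm
  ; ⊓-assoc = ⊔-assoc
  ; ¬-⊓-idem = ⌟-⊔-idem
  ; ⊓-absorb-⊔ = ⊔-absorb-⊓
  ; ⊓-distrib-∨ = ⊔-distrib-∧
  ; ⊓-absorb-∨ = ⊔-absorb-∧
  ; ¬¬-⊓ = ⌟⌟-⊔
  ; ⊓-¬ = ⊔-⌟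
  ; ¬⊥ = ⌟⊤
  ; ¬⊤ = ⌟⊥
  ; ⊔-idem-left = ⊓-idem-left
  ; ⊔-comm = ⊓-comm
  ; ⊔-assoc = ⊓-assoc
  ; ⌟-⊔-idem = ¬-⊓-idem
  ; ⊔-absorb-⊓ = ⊓-absorb-⊔
  ; ⊔-distrib-∧ = ⊓-distrib-∨
  ; ⊔-absorb-∧ = ⊓-absorb-∨
  ; ⌟⌟-⊔ = ¬¬-⊓
  ; ⊔-⌟ = ⊓-¬
  ; ⌟⊤ = ¬⊥
  ; ⌟⊥ = ¬⊤
  ; mixed = λ x → sym (mixed x)
  }
  where open DBA D

module ⊓-Properties (D : DBA a) where
  open DBA D
  open ≡-Reasoning

  ⊓-idem-right : ∀ x y → x ⊓ (y ⊓ y) ≡ x ⊓ y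
  ⊓-idem-right x y = begin
    x ⊓ (y ⊓ y)  ≡⟨ ⊓-comm x (y ⊓ y) ⟩
    (y ⊓ y) ⊓ x  ≡⟨ ⊓-idem-left y x ⟩
    y ⊓ x        ≡⟨ ⊓-comm y x ⟩
    x ⊓ y        ∎

  ⊓-≡-₊⊓-⊓-₊⊓ : ∀ x y → x ⊓ y ≡ x ₊⊓ ⊓ y ₊⊓
  ⊓-≡-₊⊓-⊓-₊⊓ x y = sym (trans (⊓-idem-left x (y ⊓ y)) (⊓-idem-right x y))

  ⊓-In⊓ : ∀ x y → In⊓ (x ⊓ y)
  ⊓-In⊓ x y = begin
    (x ⊓ y) ⊓ (x ⊓ y)  ≡⟨ sym (⊓-assoc x y (x ⊓ y)) ⟩
    x ⊓ (y ⊓ (x ⊓ y))  ≡⟨ cong (x ⊓_) (⊓-assoc y x y) ⟩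
    x ⊓ ((y ⊓ x) ⊓ y)  ≡⟨ cong (λ t → x ⊓ (t ⊓ y)) (⊓-comm y x) ⟩
    x ⊓ ((x ⊓ y) ⊓ y)  ≡⟨ cong (x ⊓_) (sym (⊓-assoc x y y)) ⟩
    x ⊓ (x ⊓ (y ⊓ y))  ≡⟨ ⊓-assoc x x (y ⊓ y) ⟩
    (x ⊓ x) ⊓ (y ⊓ y)  ≡⟨ sym (⊓-≡-₊⊓-⊓-₊⊓ x y) ⟩
    x ⊓ y              ∎

  ¬¬¬≡¬ : ∀ x → ¬ ¬ ¬ x ≡ ¬ x
  ¬¬¬≡¬ x = begin
    ¬ ¬ ¬ x          ≡⟨ cong (λ t → ¬ ¬ t) (sym (¬-⊓-idem x)) ⟩
    ¬ ¬ ¬ (x ⊓ x)    ≡⟨ cong ¬_ (¬¬-⊓ x x) ⟩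
    ¬ (x ⊓ x)        ≡⟨ ¬-⊓-idem x ⟩
    ¬ x              ∎

  ¬-In⊓ : ∀ x → In⊓ (¬ x)
  ¬-In⊓ x = begin
    ¬ x ⊓ ¬ x            ≡⟨ sym (¬¬-⊓ (¬ x) (¬ x)) ⟩
    ¬ ¬ (¬ x ⊓ ¬ x)      ≡⟨ cong ¬_ (¬-⊓-idem (¬ x)) ⟩
    ¬ ¬ ¬ x              ≡⟨ ¬¬¬≡¬ x ⟩
    ¬ x                  ∎

  ⊥-In⊓ : In⊓ ⊥
  ⊥-In⊓ = subst In⊓ (⊓-¬ ⊤) (⊓-In⊓ ⊤ (¬ ⊤))

module Properties (D : DBA a) where
  open DBA D

  open ⊓-Properties D public
  open ⊓-Properties (dual D) public using ()
    renaming (⊓-≡-₊⊓-⊓-₊⊓ to ⊔-≡-₊⊔-⊔-₊⊔; ⊓-In⊓ to ⊔-In⊔; ¬-In⊓ to ⌟-In⊔; ⊥-In⊓ to ⊤-In⊔)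

  module _ (fc : FullyContextual D) where

    glue : ∀ {y x} → In⊓ y → In⊔ x → y ₊⊔ ≡ x ₊⊓ →
           Σ[ z ∈ Carrier ] (z ₊⊓ ≡ y × z ₊⊔ ≡ x)
    glue {y} {x} y∈D⊓ x∈D⊔ compatible with proj₂ fc y x y∈D⊓ x∈D⊔ compatible
    ... | z , components , _ = z , components

    components-injective : ∀ {z w} → z ₊⊓ ≡ w ₊⊓ → z ₊⊔ ≡ w ₊⊔ → z ≡ w
    components-injective {z} {w} z⊓≡w⊓ z⊔≡w⊔
      with proj₂ fc (z ₊⊓) (z ₊⊔) (⊓-In⊓ z z) (⊔-In⊔ z z) (mixed z)
    ... | _ , _ , unique = trans (unique z (refl , refl)) (sym (unique w (sym z⊓≡w⊓ , sym z⊔≡w⊔)))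

module _ (D : DBA a) (M : DBA b) where
  private
    module D = DBA D
    module M = DBA M
    module PD = Properties D
    module PM = Properties M

  IsIso⇒IsPIso : ∀ {f} → IsIso D M f → IsPIso D M f
  IsIso⇒IsPIso {f} ((f-inj , f-surj) , f-⊔ , f-⊓ , f-¬ , f-⌟ , f-⊤ , f-⊥) =
    preserves , (λ _ _ _ _ → f-inj) , onto ,
    (λ x y _ _ → f-⊔ x y) , (λ x y _ _ → f-⊓ x y) , (λ x _ → f-¬ x) , (λ x _ → f-⌟ x) ,
    f-⊤ , f-⊥
    where
    preserves : ∀ x → D.InP x → M.InP (f x)
    preserves x (inj₁ x∈D⊓) = inj₁ (trans (sym (f-⊓ x x)) (cong f x∈D⊓))
    preserves x (inj₂ x∈D⊔) = inj₂ (trans (sym (f-⊔ x x)) (cong f x∈D⊔))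

    reflects : ∀ x → M.InP (f x) → D.InP x
    reflects x (inj₁ fx∈M⊓) = inj₁ (f-inj (trans (f-⊓ x x) fx∈M⊓))
    reflects x (inj₂ fx∈M⊔) = inj₂ (f-inj (trans (f-⊔ x x) fx∈M⊔))

    onto : ∀ u → M.InP u → ∃[ x ] (D.InP x × f x ≡ u)
    onto u u∈Mp with surjective⇒strictlySurjective f-surj u
    ... | x , refl = x , reflects x u∈Mp , refl

  ⊓⊔-homomorphisms-agreeing-on-Dp-agree :
    FullyContextual M → ∀ {f h : D.Carrier → M.Carrier} →
    (∀ x y → f (x D.⊔ y) ≡ f x M.⊔ f y) → (∀ x y → f (x D.⊓ y) ≡ f x M.⊓ f y) →
    (∀ x y → h (x D.⊔ y) ≡ h x M.⊔ h y) → (∀ x y → h (x D.⊓ y) ≡ h x M.⊓ h y) →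
    Extends D M f h → ∀ x → f x ≡ h x
  ⊓⊔-homomorphisms-agreeing-on-Dp-agree fcM f-⊔ f-⊓ h-⊔ h-⊓ f≗h x =
    PM.components-injective fcM
      (trans (sym (f-⊓ x x)) (trans (f≗h _ (inj₁ (PD.⊓-In⊓ x x))) (h-⊓ x x)))
      (trans (sym (f-⊔ x x)) (trans (f≗h _ (inj₂ (PD.⊔-In⊔ x x))) (h-⊔ x x)))

  isos-extending-the-same-map-agree :
    FullyContextual M → ∀ {f h g : D.Carrier → M.Carrier} → IsIso D M f → IsIso D M h →
    Extends D M f g → Extends D M h g → ∀ x → f x ≡ h x
  isos-extending-the-same-map-agree fcM (_ , f-⊔ , f-⊓ , _) (_ , h-⊔ , h-⊓ , _) f-extends-g h-extends-g =
    ⊓⊔-homomorphisms-agreeing-on-Dp-agree fcM f-⊔ f-⊓ h-⊔ h-⊓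
      (λ x x∈Dp → trans (f-extends-g x x∈Dp) (sym (h-extends-g x x∈Dp)))

module Extension (D : DBA a) (M : DBA b) (fcD : FullyContextual D) (fcM : FullyContextual M) where
  private
    module D = DBA D
    module M = DBA M
    module PD = Properties D
    module PM = Properties M

  module Construction
    (g : D.Carrier → M.Carrier)
    (g-inj : ∀ x y → D.InP x → D.InP y → g x ≡ g y → x ≡ y)
    (g-onto : ∀ u → M.InP u → ∃[ x ] (D.InP x × g x ≡ u))
    (g-⊔ : ∀ x y → D.InP x → D.InP y → g (x D.⊔ y) ≡ g x M.⊔ g y)
    (g-⊓ : ∀ x y → D.InP x → D.InP y → g (x D.⊓ y) ≡ g x M.⊓ g y)
    (g-¬ : ∀ x → D.InP x → g (D.¬ x) ≡ M.¬ (g x))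
    (g-⌟ : ∀ x → D.InP x → g (D.⌟ x) ≡ M.⌟ (g x))
    (g-⊤ : g D.⊤ ≡ M.⊤)
    (g-⊥ : g D.⊥ ≡ M.⊥)
    where
    open ≡-Reasoning

    ₊⊓∈Dp : ∀ x → D.InP (x D.₊⊓)
    ₊⊓∈Dp x = inj₁ (PD.⊓-In⊓ x x)

    ₊⊔∈Dp : ∀ x → D.InP (x D.₊⊔)
    ₊⊔∈Dp x = inj₂ (PD.⊔-In⊔ x x)

    g-₊⊓ : ∀ {x} → D.InP x → g (x D.₊⊓) ≡ g x M.₊⊓
    g-₊⊓ x∈Dp = g-⊓ _ _ x∈Dp x∈Dp

    g-₊⊔ : ∀ {x} → D.InP x → g (x D.₊⊔) ≡ g x M.₊⊔
    g-₊⊔ x∈Dp = g-⊔ _ _ x∈Dp x∈Dp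

    lift : ∀ x → Σ[ z ∈ M.Carrier ] (z M.₊⊓ ≡ g (x D.₊⊓) × z M.₊⊔ ≡ g (x D.₊⊔))
    lift x = PM.glue fcM g⊓∈M⊓ g⊔∈M⊔ compatible
      where
      g⊓∈M⊓ : M.In⊓ (g (x D.₊⊓))
      g⊓∈M⊓ = trans (sym (g-₊⊓ (₊⊓∈Dp x))) (cong g (PD.⊓-In⊓ x x))

      g⊔∈M⊔ : M.In⊔ (g (x D.₊⊔))
      g⊔∈M⊔ = trans (sym (g-₊⊔ (₊⊔∈Dp x))) (cong g (PD.⊔-In⊔ x x))

      compatible : g (x D.₊⊓) M.₊⊔ ≡ g (x D.₊⊔) M.₊⊓
      compatible = trans (sym (g-₊⊔ (₊⊓∈Dp x))) (trans (cong g (D.mixed x)) (g-₊⊓ (₊⊔∈Dp x)))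

    f : D.Carrier → M.Carrier
    f x = proj₁ (lift x)

    f-₊⊓ : ∀ x → f x M.₊⊓ ≡ g (x D.₊⊓)
    f-₊⊓ x = proj₁ (proj₂ (lift x))

    f-₊⊔ : ∀ x → f x M.₊⊔ ≡ g (x D.₊⊔)
    f-₊⊔ x = proj₂ (proj₂ (lift x))

    f-extends-g : Extends D M f g
    f-extends-g x x∈Dp =
      PM.components-injective fcM (trans (f-₊⊓ x) (g-₊⊓ x∈Dp)) (trans (f-₊⊔ x) (g-₊⊔ x∈Dp))

    f-⊓ : ∀ x y → f (x D.⊓ y) ≡ f x M.⊓ f y
    f-⊓ x y = begin
      f (x D.⊓ y)                  ≡⟨ f-extends-g _ (inj₁ (PD.⊓-In⊓ x y)) ⟩
      g (x D.⊓ y)                  ≡⟨ cong g (PD.⊓-≡-₊⊓-⊓-₊⊓ x y) ⟩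
      g (x D.₊⊓ D.⊓ y D.₊⊓)        ≡⟨ g-⊓ _ _ (₊⊓∈Dp x) (₊⊓∈Dp y) ⟩
      g (x D.₊⊓) M.⊓ g (y D.₊⊓)    ≡⟨ sym (cong₂ M._⊓_ (f-₊⊓ x) (f-₊⊓ y)) ⟩
      f x M.₊⊓ M.⊓ f y M.₊⊓        ≡⟨ sym (PM.⊓-≡-₊⊓-⊓-₊⊓ (f x) (f y)) ⟩
      f x M.⊓ f y                  ∎

    f-⊔ : ∀ x y → f (x D.⊔ y) ≡ f x M.⊔ f y
    f-⊔ x y = begin
      f (x D.⊔ y)                  ≡⟨ f-extends-g _ (inj₂ (PD.⊔-In⊔ x y)) ⟩
      g (x D.⊔ y)                  ≡⟨ cong g (PD.⊔-≡-₊⊔-⊔-₊⊔ x y) ⟩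
      g (x D.₊⊔ D.⊔ y D.₊⊔)        ≡⟨ g-⊔ _ _ (₊⊔∈Dp x) (₊⊔∈Dp y) ⟩
      g (x D.₊⊔) M.⊔ g (y D.₊⊔)    ≡⟨ sym (cong₂ M._⊔_ (f-₊⊔ x) (f-₊⊔ y)) ⟩
      f x M.₊⊔ M.⊔ f y M.₊⊔        ≡⟨ sym (PM.⊔-≡-₊⊔-⊔-₊⊔ (f x) (f y)) ⟩
      f x M.⊔ f y                  ∎

    f-¬ : ∀ x → f (D.¬ x) ≡ M.¬ (f x)
    f-¬ x = begin
      f (D.¬ x)          ≡⟨ f-extends-g _ (inj₁ (PD.¬-In⊓ x)) ⟩
      g (D.¬ x)          ≡⟨ cong g (sym (D.¬-⊓-idem x)) ⟩
      g (D.¬ x D.₊⊓)     ≡⟨ g-¬ _ (₊⊓∈Dp x) ⟩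
      M.¬ g (x D.₊⊓)     ≡⟨ cong M.¬_ (sym (f-₊⊓ x)) ⟩
      M.¬ (f x M.₊⊓)     ≡⟨ M.¬-⊓-idem (f x) ⟩
      M.¬ f x            ∎

    f-⌟ : ∀ x → f (D.⌟ x) ≡ M.⌟ (f x)
    f-⌟ x = begin
      f (D.⌟ x)          ≡⟨ f-extends-g _ (inj₂ (PD.⌟-In⊔ x)) ⟩
      g (D.⌟ x)          ≡⟨ cong g (sym (D.⌟-⊔-idem x)) ⟩
      g (D.⌟ x D.₊⊔)     ≡⟨ g-⌟ _ (₊⊔∈Dp x) ⟩
      M.⌟ g (x D.₊⊔)     ≡⟨ cong M.⌟_ (sym (f-₊⊔ x)) ⟩
      M.⌟ (f x M.₊⊔)     ≡⟨ M.⌟-⊔-idem (f x) ⟩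
      M.⌟ f x            ∎

    f-⊤ : f D.⊤ ≡ M.⊤
    f-⊤ = trans (f-extends-g _ (inj₂ PD.⊤-In⊔)) g-⊤

    f-⊥ : f D.⊥ ≡ M.⊥
    f-⊥ = trans (f-extends-g _ (inj₁ PD.⊥-In⊓)) g-⊥

    f-injective : ∀ {x y} → f x ≡ f y → x ≡ y
    f-injective {x} {y} fx≡fy = PD.components-injective fcD
      (g-inj _ _ (₊⊓∈Dp x) (₊⊓∈Dp y) (trans (sym (f-₊⊓ x)) (trans (cong M._₊⊓ fx≡fy) (f-₊⊓ y))))
      (g-inj _ _ (₊⊔∈Dp x) (₊⊔∈Dp y) (trans (sym (f-₊⊔ x)) (trans (cong M._₊⊔ fx≡fy) (f-₊⊔ y))))

    f-strictlySurjective : ∀ u → ∃[ z ] f z ≡ u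
    f-strictlySurjective u
      with g-onto (u M.₊⊓) (inj₁ (PM.⊓-In⊓ u u)) | g-onto (u M.₊⊔) (inj₂ (PM.⊔-In⊔ u u))
    ... | y , y∈Dp , gy≡u⊓ | x , x∈Dp , gx≡u⊔ with PD.glue fcD y∈D⊓ x∈D⊔ compatible
      where
      y∈D⊓ : D.In⊓ y
      y∈D⊓ = g-inj _ _ (₊⊓∈Dp y) y∈Dp
        (trans (g-₊⊓ y∈Dp) (trans (cong M._₊⊓ gy≡u⊓) (trans (PM.⊓-In⊓ u u) (sym gy≡u⊓))))

      x∈D⊔ : D.In⊔ x
      x∈D⊔ = g-inj _ _ (₊⊔∈Dp x) x∈Dp
        (trans (g-₊⊔ x∈Dp) (trans (cong M._₊⊔ gx≡u⊔) (trans (PM.⊔-In⊔ u u) (sym gx≡u⊔))))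

      compatible : y D.₊⊔ ≡ x D.₊⊓
      compatible = g-inj _ _ (₊⊔∈Dp y) (₊⊓∈Dp x) (begin
        g (y D.₊⊔)          ≡⟨ g-₊⊔ y∈Dp ⟩
        g y M.₊⊔            ≡⟨ cong M._₊⊔ gy≡u⊓ ⟩
        u M.₊⊓ M.₊⊔         ≡⟨ M.mixed u ⟩
        u M.₊⊔ M.₊⊓         ≡⟨ cong M._₊⊓ (sym gx≡u⊔) ⟩
        g x M.₊⊓            ≡⟨ sym (g-₊⊓ x∈Dp) ⟩
        g (x D.₊⊓)          ∎)
    ... | z , z⊓≡y , z⊔≡x = z , PM.components-injective fcM
      (trans (f-₊⊓ z) (trans (cong g z⊓≡y) gy≡u⊓))
      (trans (f-₊⊔ z) (trans (cong g z⊔≡x) gx≡u⊔))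

    f-isIso : IsIso D M f
    f-isIso = (f-injective , strictlySurjective⇒surjective f-strictlySurjective) ,
              f-⊔ , f-⊓ , f-¬ , f-⌟ , f-⊤ , f-⊥

  extension : ∀ g → IsPIso D M g → Σ[ f ∈ (D.Carrier → M.Carrier) ] (IsIso D M f × Extends D M f g)
  extension g (_ , g-inj , g-onto , g-⊔ , g-⊓ , g-¬ , g-⌟ , g-⊤ , g-⊥) = f , f-isIso , f-extends-g
    where open Construction g g-inj g-onto g-⊔ g-⊓ g-¬ g-⌟ g-⊤ g-⊥

mainTheorem13 : ∀ {a b} (D : DBA a) (M : DBA b) →
  FullyContextual D → FullyContextual M →
  (Σ (DBA.Carrier D → DBA.Carrier M) (IsIso D M) →
     Σ (DBA.Carrier D → DBA.Carrier M) (IsPIso D M)) ×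
  (Σ (DBA.Carrier D → DBA.Carrier M) (IsPIso D M) →
     Σ (DBA.Carrier D → DBA.Carrier M) (IsIso D M)) ×
  ((g : DBA.Carrier D → DBA.Carrier M) → IsPIso D M g →
     Σ (DBA.Carrier D → DBA.Carrier M) (λ f →
       (IsIso D M f × Extends D M f g) ×
       ((f' : DBA.Carrier D → DBA.Carrier M) → IsIso D M f' → Extends D M f' g →
         ∀ x → f' x ≡ f x)))
mainTheorem13 D M fcD fcM =
    (λ (f , f-isIso) → f , IsIso⇒IsPIso D M f-isIso)
  , (λ (g , g-isPIso) → let (f , f-isIso , _) = extension g g-isPIso in f , f-isIso)
  , λ g g-isPIso → let (f , f-isIso , f-extends-g) = extension g g-isPIso in
      f , (f-isIso , f-extends-g) , λ f' f'-isIso f'-extends-g →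
        isos-extending-the-same-map-agree D M fcM f'-isIso f-isIso f'-extends-g f-extends-g
  where open Extension D M fcD fcM
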